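{- Let $R$, $S$, $T$ be multirelations of appropriate types with $R$ inner deterministic. Then \begin{enumerate} \item $R \ast S = R\, 1^{\smile} S$, \item $R \ast (S \ast T) = (R \ast S) \ast T$. \end{enumerate}
   Context: A multirelation is a binary relation $X \leftrightarrow \mathcal{P} Y$; juxtaposition denotes relational composition (diagrammatic order) and $R^{\smile}$ denotes the converse of $R$. $1 = \{(b,\{b\}) \mid b \in Y\}$. Peleg composition of $R : X \leftrightarrow \mathcal{P} Y$ and $S : Y \leftrightarrow \mathcal{P} Z$ is $R \ast S = \{(a,C) \mid \exists B.\ (a,B) \in R \wedge \exists f : Y \to \mathcal{P} Z.\ f|_B \subseteq S \wedge C = \bigcup f(B)\}$, equivalently $R \ast S = R S_\ast$ where $S_\ast = \{(A,B) \mid \exists f.\ f|_A \subseteq S \wedge B = \bigcup f(A)\}$ is the Peleg lifting. $R$ is inner deterministic if for every $(a,B) \in R$ the set $B$ is a singleton (equivalently $R = R\,1^{\smile} 1$). -}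

module Defs where

open import Level using (Level; 0ℓ; Lift)
open import Data.Product using (Σ; ∃; ∃-syntax; _×_; _,_)
open import Relation.Binary.PropositionalEquality using (_≡_)

𝒫 : Set → Set₁
𝒫 Y = Y → Set

_≐ₛ_ : {Y : Set} → 𝒫 Y → 𝒫 Y → Set
A ≐ₛ B = (∀ y → A y → B y) × (∀ y → B y → A y)

｛_｝ : {Y : Set} → Y → 𝒫 Y
｛ b ｝ = λ y → y ≡ b

⋃[_]_ : {Y Z : Set} → (Y → 𝒫 Z) → 𝒫 Y → 𝒫 Z
⋃[ f ] B = λ z → ∃[ b ] (B b × f b z)

Rel : Set₁ → Set₁ → Set₂
Rel A B = A → B → Set₁

_⨾_ : {A B C : Set₁} → Rel A B → Rel B C → Rel A C
(R ⨾ S) a c = ∃[ b ] (R a b × S b c)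

_˘ : {A B : Set₁} → Rel A B → Rel B A
(R ˘) b a = R a b

_≐_ : {A B : Set₁} → Rel A B → Rel A B → Set₁
R ≐ S = ∀ a b → (R a b → S a b) × (S a b → R a b)

-- Lift a small set to Set₁ so that small types can be relation carriers.
⟦_⟧ : Set → Set₁
⟦ X ⟧ = Lift (Level.suc 0ℓ) X

MRel : Set → Set → Set₂
MRel X Y = Rel ⟦ X ⟧ (𝒫 Y)

-- Since 𝒫 Y is modelled by predicates, a multirelation must respect
-- extensional equality of its set argument (automatic in set theory).
Extensional : {X Y : Set} → MRel X Y → Set₁
Extensional R = ∀ a B B′ → B ≐ₛ B′ → R a B → R a B′

𝟏 : {Y : Set} → MRel Y Y
𝟏 (Level.lift b) B = Lift (Level.suc 0ℓ) (B ≐ₛ ｛ b ｝)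

-- Peleg lifting S_* = {(A,B) | ∃ f. f|_A ⊆ S ∧ B = ⋃ f(A)}
_⋆ : {Y Z : Set} → MRel Y Z → Rel (𝒫 Y) (𝒫 Z)
(S ⋆) A B = ∃[ f ] (Lift (Level.suc 0ℓ) (∀ b → A b → S (Level.lift b) (f b)) × Lift (Level.suc 0ℓ) (B ≐ₛ (⋃[ f ] A)))

_∗_ : {X Y Z : Set} → MRel X Y → MRel Y Z → MRel X Z
R ∗ S = R ⨾ (S ⋆)

InnerDeterministic : {X Y : Set} → MRel X Y → Set₁
InnerDeterministic R = R ≐ ((R ⨾ (𝟏 ˘)) ⨾ 𝟏)

{-# OPTIONS --safe #-}
module Submission where

-- An inner deterministic R relates each a only to singletons {y}, and on a
-- singleton the Peleg lifting S⋆ is S itself (choose f constantly C); so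
-- R ∗ S = R 1˘ S.  Associativity then reduces to associativity of ordinary
-- relational composition, since S ∗ T is extensional whatever S and T are.

open import Defs
open import Level using (lift)
open import Data.Product using (_×_; _,_; proj₁; proj₂)
open import Relation.Binary.PropositionalEquality using (refl; subst; sym)

≐-sym : {A B : Set₁} {R S : Rel A B} → R ≐ S → S ≐ R
≐-sym R≐S a b = proj₂ (R≐S a b) , proj₁ (R≐S a b)

≐-trans : {A B : Set₁} {R S T : Rel A B} → R ≐ S → S ≐ T → R ≐ T
≐-trans R≐S S≐T a b =
  (λ r → proj₁ (S≐T a b) (proj₁ (R≐S a b) r)) ,
  (λ t → proj₂ (R≐S a b) (proj₂ (S≐T a b) t))

⨾-assoc : {A B C D : Set₁} (R : Rel A B) (S : Rel B C) (T : Rel C D) →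
          ((R ⨾ S) ⨾ T) ≐ (R ⨾ (S ⨾ T))
⨾-assoc R S T a d =
  (λ { (c , (b , r , s) , t) → b , r , c , s , t }) ,
  (λ { (b , r , c , s , t) → c , (b , r , s) , t })

⨾-congˡ : {A B C : Set₁} {R R′ : Rel A B} (S : Rel B C) → R ≐ R′ → (R ⨾ S) ≐ (R′ ⨾ S)
⨾-congˡ S R≐R′ a c =
  (λ { (b , r , s) → b , proj₁ (R≐R′ a b) r , s }) ,
  (λ { (b , r′ , s) → b , proj₂ (R≐R′ a b) r′ , s })

∗-extensional : {X Y Z : Set} (R : MRel X Y) (S : MRel Y Z) → Extensional (R ∗ S)
∗-extensional R S a C C′ (C⊆C′ , C′⊆C) (B , r , f , fS , lift (C⊆⋃ , ⋃⊆C)) =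
  B , r , f , fS , lift ((λ z c′ → C⊆⋃ z (C′⊆C z c′)) , (λ z u → C⊆C′ z (⋃⊆C z u)))

module _ {Y Z : Set} (S : MRel Y Z) where

  𝟏˘⨾⊆⋆ : ∀ B C → ((𝟏 ˘) ⨾ S) B C → (S ⋆) B C
  𝟏˘⨾⊆⋆ B C (lift y , lift (B⊆y , y⊆B) , s) =
    (λ _ → C) ,
    lift (λ b Bb → subst (λ w → S (lift w) C) (sym (B⊆y b Bb)) s) ,
    lift ((λ z c → y , y⊆B y refl , c) , (λ { z (_ , _ , c) → c }))

  ⋆-singleton : Extensional S → ∀ {y B C} → B ≐ₛ ｛ y ｝ → (S ⋆) B C → S (lift y) C
  ⋆-singleton extS {y} {B} {C} (B⊆y , y⊆B) (f , lift fS , lift (C⊆⋃ , ⋃⊆C)) =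
    extS (lift y) (f y) C (fy⊆C , C⊆fy) (fS y (y⊆B y refl))
    where
    fy⊆C : ∀ z → f y z → C z
    fy⊆C z fyz = ⋃⊆C z (y , y⊆B y refl , fyz)
    C⊆fy : ∀ z → C z → f y z
    C⊆fy z c with C⊆⋃ z c
    ... | b , Bb , fbz = subst (λ w → f w z) (B⊆y b Bb) fbz

∗-innerDeterministic : {X Y Z : Set} (R : MRel X Y) (S : MRel Y Z) →
                       InnerDeterministic R → Extensional S →
                       (R ∗ S) ≐ ((R ⨾ (𝟏 ˘)) ⨾ S)
∗-innerDeterministic R S detR extS a C = to , from
  where
  to : (R ∗ S) a C → ((R ⨾ (𝟏 ˘)) ⨾ S) a C
  to (B , r , s⋆) with proj₁ (detR a B) r
  ... | y , r𝟏˘ , lift B≐y = y , r𝟏˘ , ⋆-singleton S extS B≐y s⋆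
  from : ((R ⨾ (𝟏 ˘)) ⨾ S) a C → (R ∗ S) a C
  from (y , (B , r , 𝟏yB) , s) = B , r , 𝟏˘⨾⊆⋆ S B C (y , 𝟏yB , s)

lemma3p10 : {X Y Z W : Set} (R : MRel X Y) (S : MRel Y Z) (T : MRel Z W) →
              Extensional R → Extensional S → Extensional T →
              InnerDeterministic R →
              ((R ∗ S) ≐ ((R ⨾ (𝟏 ˘)) ⨾ S)) × ((R ∗ (S ∗ T)) ≐ ((R ∗ S) ∗ T))
lemma3p10 R S T _ extS _ detR = R∗S≐R𝟏˘S , ∗-assoc
  where
  R∗S≐R𝟏˘S : (R ∗ S) ≐ ((R ⨾ (𝟏 ˘)) ⨾ S)
  R∗S≐R𝟏˘S = ∗-innerDeterministic R S detR extS
  ∗-assoc : (R ∗ (S ∗ T)) ≐ ((R ∗ S) ∗ T)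
  ∗-assoc =
    ≐-trans (∗-innerDeterministic R (S ∗ T) detR (∗-extensional S T))
   (≐-trans (≐-sym (⨾-assoc (R ⨾ (𝟏 ˘)) S (T ⋆)))
            (⨾-congˡ (T ⋆) (≐-sym R∗S≐R𝟏˘S)))
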